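{- Let $n\ge 3$, $M_n=\{1,2,\dots,n\}$, and let $\mathcal{F}\subseteq 2^{M_n}$ be a union-closed family with $\emptyset\in\mathcal{F}$ and $\bigcup_{A\in\mathcal{F}}A=M_n$. Let $T(\mathcal{F})=\min\{1\le k\le n:\ \mathcal{F}\text{ contains a set of cardinality }k\}$. If $T(\mathcal{F})=n-1$, then there exist at least $n-1$ distinct elements $i\in M_n$ such that $|\{A\in\mathcal{F}: i\in A\}|\ge \tfrac12|\mathcal{F}|$.
   Context: A family $\mathcal{F}$ is union-closed if $A\cup B\in\mathcal{F}$ for all $A,B\in\mathcal{F}$. -}

module Defs where

open import Data.Nat using (ℕ; _≤_; _*_; _∸_; suc)
open import Data.Fin using (Fin)
open import Data.Fin.Subset using (Subset; _∪_; ∣_∣; ⊥; _∈_)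
open import Data.List using (List; length; filter)
open import Data.List.Relation.Unary.Unique.Propositional using (Unique)
import Data.List.Membership.Propositional as LM
open import Data.Product using (Σ; ∃; _×_; _,_)
open import Relation.Binary.PropositionalEquality using (_≡_)
open import Relation.Nullary using (¬_)
open import Relation.Unary using (Pred)
open import Data.Fin.Subset.Properties using (_∈?_)

record Family (n : ℕ) : Set where
  constructor family
  field
    sets   : List (Subset n)
    unique : Unique sets

open Family public

_∈F_ : ∀ {n} → Subset n → Family n → Set
A ∈F F = A LM.∈ sets F

UnionClosed : ∀ {n} → Family n → Set
UnionClosed F = ∀ A B → A ∈F F → B ∈F F → (A ∪ B) ∈F F

CoversGround : ∀ {n} → Family n → Set
CoversGround {n} F = ∀ (i : Fin n) → ∃ λ A → A ∈F F × i ∈ A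

ContainsSetOfSize : ∀ {n} → Family n → ℕ → Set
ContainsSetOfSize F k = ∃ λ A → A ∈F F × ∣ A ∣ ≡ k

TIs : ∀ {n} → Family n → ℕ → Set
TIs {n} F k =
  (1 ≤ k × k ≤ n × ContainsSetOfSize F k)
  × (∀ j → 1 ≤ j → j ≤ n → ContainsSetOfSize F j → k ≤ j)

card : ∀ {n} → Family n → ℕ
card F = length (sets F)

degree : ∀ {n} → Family n → Fin n → ℕ
degree F i = length (filter (i ∈?_) (sets F))

Abundant : ∀ {n} → Family n → Fin n → Set
Abundant F i = card F ≤ 2 * degree F i

-- A nonempty member of F has at least n − 1 elements, so a nonempty member missing j
-- is M_n ∖ {j}. Hence the members missing j are ∅ and possibly M_n ∖ {j}: at most two,
-- and only one unless M_n ∖ {j} ∈ F. If no co-singleton M_n ∖ {i} lies in F, every j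
-- is missed only by ∅ and lies in some member. Otherwise fix M_n ∖ {i} ∈ F; for j ≠ i,
-- either j is missed only by ∅, or M_n ∖ {j} ∈ F and j lies in the two distinct members
-- M_n ∖ {i} and (M_n ∖ {i}) ∪ (M_n ∖ {j}). Either way j is abundant.
module Submission where

open import Defs
open import Data.Nat using (ℕ; suc; _+_; _*_; _≤_; _∸_; z≤n; s≤s)
open import Data.Nat.Properties
  using (≤-refl; ≤-reflexive; ≤-trans; m≤n⇒m≤1+n; 1+n≰n; ∸-monoˡ-≤; +-suc; +-mono-≤; +-monoʳ-≤; +-identityʳ; module ≤-Reasoning)
open import Data.Fin using (Fin; zero; punchIn)
open import Data.Fin.Properties using (punchIn-injective; punchInᵢ≢i) renaming (any? to anyFin?)
open import Data.Fin.Subset using (Subset; ⊥; ⁅_⁆; _∪_; ∣_∣; _∈_; _∉_; _⊆_; _⊂_; Nonempty)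
open import Data.Fin.Subset.Properties
  using (_∈?_; nonempty?; Empty-unique; ⊆-antisym; p⊆p∪q; x∈p∪q⁺; x∈p∪q⁻; x∈⁅x⁆; x∈⁅y⁆⇒x≡y;
         ∣⁅x⁆∣≡1; ∣p∣≤n; p⊆q⇒∣p∣≤∣q∣; p⊂q⇒∣p∣<∣q∣)
open import Data.List using (List; []; _∷_; length; filter; tabulate)
open import Data.List.Properties using (filter-none; length-tabulate)
open import Data.List.Relation.Unary.All using (All; []; _∷_)
import Data.List.Relation.Unary.All as All
import Data.List.Relation.Unary.All.Properties as All
open import Data.List.Relation.Unary.AllPairs using ([]; _∷_)
open import Data.List.Relation.Unary.Any using (Any; here; there; any?)
open import Data.List.Relation.Unary.Unique.Propositional using (Unique)
import Data.List.Relation.Unary.Unique.Propositional.Properties as Unique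
import Data.List.Membership.Propositional as List
open import Data.List.Membership.Propositional.Properties using (∈-filter⁺; ∈-filter⁻; ∈-length)
open import Data.Product using (Σ; ∃; _×_; _,_; proj₁; proj₂)
open import Data.Sum using (inj₁; inj₂)
open import Relation.Nullary using (¬_; yes; no; contradiction; _×-dec_)
open import Relation.Binary.PropositionalEquality using (_≡_; _≢_; refl; sym; trans; cong; subst)
open import Relation.Unary using (Pred; Decidable; ∁)
open import Relation.Unary.Properties using (∁?)

x∈p⇒1≤∣p∣ : ∀ {n} {x : Fin n} {p} → x ∈ p → 1 ≤ ∣ p ∣
x∈p⇒1≤∣p∣ {x = x} {p = p} x∈p = subst (_≤ ∣ p ∣) (∣⁅x⁆∣≡1 x) (p⊆q⇒∣p∣≤∣q∣ ⁅x⁆⊆p)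
  where
  ⁅x⁆⊆p : ⁅ x ⁆ ⊆ p
  ⁅x⁆⊆p y∈⁅x⁆ = subst (_∈ p) (sym (x∈⁅y⁆⇒x≡y x y∈⁅x⁆)) x∈p

x∉p⇒p⊂p∪⁅x⁆ : ∀ {n} {x : Fin n} {p} → x ∉ p → p ⊂ p ∪ ⁅ x ⁆
x∉p⇒p⊂p∪⁅x⁆ {x = x} x∉p = p⊆p∪q ⁅ x ⁆ , x , x∈p∪q⁺ (inj₂ (x∈⁅x⁆ x)) , x∉p

x≢y∧x,y∉p⇒2+∣p∣≤n : ∀ {n} {x y : Fin n} {p} → x ≢ y → x ∉ p → y ∉ p → 2 + ∣ p ∣ ≤ n
x≢y∧x,y∉p⇒2+∣p∣≤n {n} {x} {y} {p} x≢y x∉p y∉p = begin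
  2 + ∣ p ∣               ≤⟨ s≤s (p⊂q⇒∣p∣<∣q∣ (x∉p⇒p⊂p∪⁅x⁆ x∉p)) ⟩
  1 + ∣ p ∪ ⁅ x ⁆ ∣         ≤⟨ p⊂q⇒∣p∣<∣q∣ (x∉p⇒p⊂p∪⁅x⁆ {p = p ∪ ⁅ x ⁆} y∉p∪⁅x⁆) ⟩
  ∣ (p ∪ ⁅ x ⁆) ∪ ⁅ y ⁆ ∣   ≤⟨ ∣p∣≤n ((p ∪ ⁅ x ⁆) ∪ ⁅ y ⁆) ⟩
  n                       ∎
  where
  open ≤-Reasoning
  y∉p∪⁅x⁆ : y ∉ p ∪ ⁅ x ⁆
  y∉p∪⁅x⁆ y∈ with x∈p∪q⁻ p ⁅ x ⁆ y∈
  ... | inj₁ y∈p   = y∉p y∈p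
  ... | inj₂ y∈⁅x⁆ = x≢y (sym (x∈⁅y⁆⇒x≡y x y∈⁅x⁆))

n∸1≤∣p∣∧x∉p⇒y∈p : ∀ {n} {x y : Fin n} {p} → n ∸ 1 ≤ ∣ p ∣ → x ∉ p → y ≢ x → y ∈ p
n∸1≤∣p∣∧x∉p⇒y∈p {y = y} {p = p} large x∉p y≢x with y ∈? p
... | yes y∈p = y∈p
... | no  y∉p = contradiction
  (≤-trans (∸-monoˡ-≤ 1 (x≢y∧x,y∉p⇒2+∣p∣≤n (λ x≡y → y≢x (sym x≡y)) x∉p y∉p)) large)
  1+n≰n

n∸1≤∣p∣,∣q∣∧x∉p,q⇒p≡q : ∀ {n} {x : Fin n} {p q} →
                        n ∸ 1 ≤ ∣ p ∣ → n ∸ 1 ≤ ∣ q ∣ → x ∉ p → x ∉ q → p ≡ q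
n∸1≤∣p∣,∣q∣∧x∉p,q⇒p≡q {n} {x} largeᵖ largeᑫ x∉p x∉q =
  ⊆-antisym (⊆-missing largeᑫ x∉p x∉q) (⊆-missing largeᵖ x∉q x∉p)
  where
  ⊆-missing : ∀ {p q} → n ∸ 1 ≤ ∣ q ∣ → x ∉ p → x ∉ q → p ⊆ q
  ⊆-missing largeᑫ x∉p x∉q y∈p = n∸1≤∣p∣∧x∉p⇒y∈p largeᑫ x∉q λ { refl → x∉p y∈p }

module _ {a} {A : Set a} where

  length-filter-∁ : ∀ {ℓ} {P : Pred A ℓ} (P? : Decidable P) (xs : List A) →
                    length xs ≡ length (filter P? xs) + length (filter (∁? P?) xs)
  length-filter-∁ P? [] = refl
  length-filter-∁ P? (x ∷ xs) with P? x
  ... | yes _ = cong suc (length-filter-∁ P? xs)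
  ... | no  _ = trans (cong suc (length-filter-∁ P? xs)) (sym (+-suc _ _))

  Unique∧pairwise-≡⇒length≤1 : ∀ {xs : List A} → Unique xs →
    (∀ {x y} → x List.∈ xs → y List.∈ xs → x ≡ y) → length xs ≤ 1
  Unique∧pairwise-≡⇒length≤1 []                  _  = z≤n
  Unique∧pairwise-≡⇒length≤1 (_ ∷ [])            _  = ≤-refl
  Unique∧pairwise-≡⇒length≤1 ((x≢y ∷ _) ∷ _ ∷ _) eq =
    contradiction (eq (here refl) (there (here refl))) x≢y

  ∈∧∈∧≢⇒2≤length : ∀ {x y} {xs : List A} → x List.∈ xs → y List.∈ xs → x ≢ y → 2 ≤ length xs
  ∈∧∈∧≢⇒2≤length (here refl)  (here refl)  x≢y = contradiction refl x≢y
  ∈∧∈∧≢⇒2≤length (here _)     (there y∈xs) _   = s≤s (∈-length y∈xs)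
  ∈∧∈∧≢⇒2≤length (there x∈xs) (here _)     _   = s≤s (∈-length x∈xs)
  ∈∧∈∧≢⇒2≤length (there x∈xs) (there y∈xs) x≢y = m≤n⇒m≤1+n (∈∧∈∧≢⇒2≤length x∈xs y∈xs x≢y)

module _ {n} (F : Family n) (∪-closed : UnionClosed F) (covers : CoversGround F)
         (large : ∀ {A} → A ∈F F → Nonempty A → n ∸ 1 ≤ ∣ A ∣) where

  -- In F such a set can only be M_n ∖ {j}.
  Coatom : Fin n → Subset n → Set
  Coatom j A = Nonempty A × j ∉ A

  coatom? : ∀ j → Decidable (Coatom j)
  coatom? j A = nonempty? A ×-dec ∁? (j ∈?_) A

  coatom-unique : ∀ {j A B} → A ∈F F → B ∈F F → Coatom j A → Coatom j B → A ≡ B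
  coatom-unique A∈F B∈F (neᴬ , j∉A) (neᴮ , j∉B) =
    n∸1≤∣p∣,∣q∣∧x∉p,q⇒p≡q (large A∈F neᴬ) (large B∈F neᴮ) j∉A j∉B

  coatom-∋ : ∀ {i j A} → A ∈F F → Coatom j A → i ≢ j → i ∈ A
  coatom-∋ A∈F (ne , j∉A) = n∸1≤∣p∣∧x∉p⇒y∈p (large A∈F ne) j∉A

  Missing : Fin n → List (Subset n)
  Missing j = filter (∁? (j ∈?_)) (sets F)

  coDegree : Fin n → ℕ
  coDegree j = length (Missing j)

  coDegree≤degree⇒Abundant : ∀ j → coDegree j ≤ degree F j → Abundant F j
  coDegree≤degree⇒Abundant j le = begin
    card F                       ≡⟨ length-filter-∁ (j ∈?_) (sets F) ⟩
    degree F j + coDegree j      ≤⟨ +-monoʳ-≤ (degree F j) le ⟩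
    degree F j + degree F j      ≡⟨ cong (degree F j +_) (sym (+-identityʳ (degree F j))) ⟩
    2 * degree F j               ∎
    where open ≤-Reasoning

  1≤degree : ∀ j → 1 ≤ degree F j
  1≤degree j = let A , A∈F , j∈A = covers j in ∈-length (∈-filter⁺ (j ∈?_) A∈F j∈A)

  2≤degree : ∀ {i j A B} → A ∈F F → B ∈F F → Coatom j A → Coatom i B → i ≢ j → 2 ≤ degree F j
  2≤degree {i} {j} {A} {B} A∈F B∈F coᴬ coᴮ@(_ , i∉B) i≢j =
    ∈∧∈∧≢⇒2≤length (∈-filter⁺ (j ∈?_) (∪-closed A B A∈F B∈F) (x∈p∪q⁺ (inj₂ j∈B)))
                   (∈-filter⁺ (j ∈?_) B∈F j∈B)
                   (λ A∪B≡B → i∉B (subst (i ∈_) A∪B≡B (x∈p∪q⁺ (inj₁ i∈A))))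
    where
    j∈B : j ∈ B
    j∈B = coatom-∋ B∈F coᴮ (λ j≡i → i≢j (sym j≡i))
    i∈A : i ∈ A
    i∈A = coatom-∋ A∈F coᴬ i≢j

  coDegree≡coatoms+empties : ∀ j → coDegree j ≡
    length (filter nonempty? (Missing j)) + length (filter (∁? nonempty?) (Missing j))
  coDegree≡coatoms+empties j = length-filter-∁ nonempty? (Missing j)

  #empties≤1 : ∀ j → length (filter (∁? nonempty?) (Missing j)) ≤ 1
  #empties≤1 j = Unique∧pairwise-≡⇒length≤1 (Unique.filter⁺ _ (Unique.filter⁺ _ (unique F)))
    λ A∈ B∈ → trans (empty A∈) (sym (empty B∈))
    where
    empty : ∀ {A} → A List.∈ filter (∁? nonempty?) (Missing j) → A ≡ ⊥
    empty A∈ = Empty-unique (proj₂ (∈-filter⁻ (∁? nonempty?) {xs = Missing j} A∈))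

  #coatoms≤1 : ∀ j → length (filter nonempty? (Missing j)) ≤ 1
  #coatoms≤1 j = Unique∧pairwise-≡⇒length≤1 (Unique.filter⁺ _ (Unique.filter⁺ _ (unique F)))
    λ A∈ B∈ → let A∈F , coᴬ = coatom-of A∈ ; B∈F , coᴮ = coatom-of B∈
              in coatom-unique A∈F B∈F coᴬ coᴮ
    where
    coatom-of : ∀ {A} → A List.∈ filter nonempty? (Missing j) → A ∈F F × Coatom j A
    coatom-of A∈ = let A∈M , ne = ∈-filter⁻ nonempty? A∈ ; A∈F , j∉A = ∈-filter⁻ (∁? (j ∈?_)) A∈M
                   in A∈F , ne , j∉A

  coDegree≤2 : ∀ j → coDegree j ≤ 2
  coDegree≤2 j = ≤-trans (≤-reflexive (coDegree≡coatoms+empties j))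
                         (+-mono-≤ (#coatoms≤1 j) (#empties≤1 j))

  coDegree≤1 : ∀ j → ¬ Any (Coatom j) (sets F) → coDegree j ≤ 1
  coDegree≤1 j noCoatom = begin
    coDegree j                                                    ≡⟨ coDegree≡coatoms+empties j ⟩
    length (filter nonempty? (Missing j)) + #empties              ≡⟨ cong (λ xs → length xs + #empties)
                                                                          (filter-none nonempty? noNonempty) ⟩
    #empties                                                      ≤⟨ #empties≤1 j ⟩
    1                                                             ∎
    where
    open ≤-Reasoning
    #empties : ℕ
    #empties = length (filter (∁? nonempty?) (Missing j))

    noNonempty : All (∁ Nonempty) (Missing j)
    noNonempty = All.tabulate λ A∈ ne →
      let A∈F , j∉A = ∈-filter⁻ (∁? (j ∈?_)) A∈ in noCoatom (List.lose A∈F (ne , j∉A))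

  abundant-without-coatom : ∀ j → ¬ Any (Coatom j) (sets F) → Abundant F j
  abundant-without-coatom j noCoatom =
    coDegree≤degree⇒Abundant j (≤-trans (coDegree≤1 j noCoatom) (1≤degree j))

  abundant-beside-coatom : ∀ {i j B} → B ∈F F → Coatom i B → j ≢ i → Abundant F j
  abundant-beside-coatom {j = j} B∈F coᴮ j≢i with any? (coatom? j) (sets F)
  ... | no noCoatom = abundant-without-coatom j noCoatom
  ... | yes hasCoatom =
    let A , A∈F , coᴬ = List.find hasCoatom
    in coDegree≤degree⇒Abundant j
         (≤-trans (coDegree≤2 j) (2≤degree A∈F B∈F coᴬ coᴮ (λ i≡j → j≢i (sym i≡j))))

  all-but-one-abundant : Fin n → ∃ λ i → ∀ j → j ≢ i → Abundant F j
  all-but-one-abundant i₀ with anyFin? (λ i → any? (coatom? i) (sets F))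
  ... | no noCoatoms = i₀ , λ j _ → abundant-without-coatom j (λ hasCoatom → noCoatoms (j , hasCoatom))
  ... | yes (i , hasCoatom) =
    let B , B∈F , coᴮ = List.find hasCoatom in i , λ j → abundant-beside-coatom B∈F coᴮ

mainTheorem3 : (n : ℕ) → 3 ≤ n → (F : Family n) → UnionClosed F → ⊥ ∈F F → CoversGround F → TIs F (n ∸ 1) → Σ (List (Fin n)) (λ is → Unique is × (n ∸ 1) ≤ length is × All (Abundant F) is)
mainTheorem3 (suc m) _ F ∪-closed _ covers (_ , minimal) =
    tabulate (punchIn i)
  , Unique.tabulate⁺ (punchIn-injective i _ _)
  , ≤-reflexive (sym (length-tabulate (punchIn i)))
  , All.tabulate⁺ (λ j → abundant (punchIn i j) (punchInᵢ≢i i j))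
  where
  large : ∀ {A} → A ∈F F → Nonempty A → m ≤ ∣ A ∣
  large {A} A∈F (_ , x∈A) = minimal ∣ A ∣ (x∈p⇒1≤∣p∣ x∈A) (∣p∣≤n A) (A , A∈F , refl)

  i : Fin (suc m)
  i = proj₁ (all-but-one-abundant F ∪-closed covers large zero)

  abundant : ∀ j → j ≢ i → Abundant F j
  abundant = proj₂ (all-but-one-abundant F ∪-closed covers large zero)
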